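{- Let $N\ge1$, let $p,q\ge0$ with $p+q\le N$, and let $f$ be a vertex function on $\mathcal{C}_5^N$ supported in $\Sigma_{p,q}$. Then for every $v\in\Sigma_{p,q}$, $$\Big(A_{(p-1,q+1)\to(p,q)}\big(A_{(p-1,q+1)\to(p-1,q+1)}A_{(p,q)\to(p-1,q+1)}-A_{(p,q)\to(p-1,q+1)}A_{(p,q)\to(p,q)}\big)f\Big)(v)=(R_1f)(v)-(A_0f)(v)+\sum_{\nu:\,d_\nu(v)=2}\big(\rho_\nu A_{(p,q)\to(p+1,q-1)}f\big)(v_\nu^-).$$
   Context: Vertices of $\mathcal{C}_5^N$ are elements $v=(\ell_1,\dots,\ell_N)$ of $\mathbb{Z}_5^N$ with $\ell_i\in\{ -2,-1,0,1,2\}$; $v\sim w$ iff $v-w=\pm e_k$ (mod 5) for some $k$. Levels: $d_k(v)=|\ell_k|$, $d(v)=\sum_kd_k(v)$. $\Sigma_{p,q}$ is the set of vertices with exactly $p$ coordinates of level one and exactly $q$ coordinates of level two (empty if $p<0$ or $q<0$). The $k$-reflection $\tilde v_k$ replaces $\ell_k$ by $-\ell_k$, and $(\rho_kh)(x)=h(\tilde x_k)$. For $v$ with $d_\nu(v)=2$, $v_\nu^-$ is the vertex obtained by replacing $\ell_\nu=\pm2$ by $\pm1$ (same sign). Vertex functions are maps $\mathbb{Z}_5^N\to\mathbb{C}$. For index pairs $(a,b),(a',b')$, the subadjacency $A_{(a,b)\to(a',b')}$ is defined by $(A_{(a,b)\to(a',b')}g)(w)=\sum_{u\in\Sigma_{a,b},\,u\sim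 w}g(u)$ if $w\in\Sigma_{a',b'}$ and $0$ otherwise; in particular $(A_{(a,b)\to(a,b)}g)(w)=\sum_{k:\,d_k(w)=2}g(\tilde w_k)$ for $w\in\Sigma_{a,b}$. The neutral adjacency is $(A_0f)(v)=\sum_{k:\,d_k(v)=2}f(\tilde v_k)$ and the level-one reflection operator is $(R_1f)(v)=\sum_{k:\,d_k(v)=1}f(\tilde v_k)$. -}

module Defs where

open import Level using (Level)
open import Data.Nat as ℕ using (ℕ; zero; suc)
open import Data.Integer as ℤ using (ℤ; +_)
open import Data.Fin using (Fin; zero; suc; _≟_)
open import Data.Vec as Vec using (Vec; []; _∷_; lookup; _[_]≔_)
open import Data.List as List using (List; []; _∷_; allFin; concatMap)
open import Data.Product using (_×_; _,_)
open import Data.Sum using (_⊎_)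
open import Relation.Nullary using (Dec; yes; no; does; ¬_)
open import Relation.Nullary.Decidable using (_×-dec_; _⊎-dec_; _→-dec_; ¬?)
open import Data.Fin.Properties using (any?; all?)
open import Relation.Binary.PropositionalEquality using (_≡_)
open import Data.Bool using (if_then_else_)
open import Algebra.Bundles using (CommutativeRing)

-- The balanced
-- representative ℓ ∈ {-2,-1,0,1,2} of a residue r is r for r ≤ 2 and
-- r - 5 for r ≥ 3, so residue 3 is ℓ = -2 and residue 4 is ℓ = -1.

Z5 : Set
Z5 = Fin 5

inc5 : Z5 → Z5
inc5 zero = suc zero
inc5 (suc zero) = suc (suc zero)
inc5 (suc (suc zero)) = suc (suc (suc zero))
inc5 (suc (suc (suc zero))) = suc (suc (suc (suc zero)))
inc5 (suc (suc (suc (suc zero)))) = zero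

dec5 : Z5 → Z5
dec5 zero = suc (suc (suc (suc zero)))
dec5 (suc zero) = zero
dec5 (suc (suc zero)) = suc zero
dec5 (suc (suc (suc zero))) = suc (suc zero)
dec5 (suc (suc (suc (suc zero)))) = suc (suc (suc zero))

neg5 : Z5 → Z5
neg5 zero = zero
neg5 (suc zero) = suc (suc (suc (suc zero)))
neg5 (suc (suc zero)) = suc (suc (suc zero))
neg5 (suc (suc (suc zero))) = suc (suc zero)
neg5 (suc (suc (suc (suc zero)))) = suc zero

lev : Z5 → ℕ
lev zero = 0
lev (suc zero) = 1
lev (suc (suc zero)) = 2
lev (suc (suc (suc zero))) = 2
lev (suc (suc (suc (suc zero)))) = 1

-- ℓ = ±2 ↦ ±1 (same sign); other values unchanged (only used at level 2)
lower5 : Z5 → Z5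
lower5 (suc (suc zero)) = suc zero
lower5 (suc (suc (suc zero))) = suc (suc (suc (suc zero)))
lower5 x = x

allZ5 : List Z5
allZ5 = allFin 5

Vertex : ℕ → Set
Vertex N = Vec Z5 N

allVertices : (N : ℕ) → List (Vertex N)
allVertices zero = [] ∷ []
allVertices (suc N) = concatMap (λ x → List.map (x ∷_) (allVertices N)) allZ5

_∼_ : {N : ℕ} → Vertex N → Vertex N → Set
_∼_ {N} v w = Data.Product.Σ (Fin N) λ k →
  ((lookup v k ≡ inc5 (lookup w k)) ⊎ (lookup v k ≡ dec5 (lookup w k)))
  × (∀ j → ¬ (j ≡ k) → lookup v j ≡ lookup w j)

adj? : {N : ℕ} (u w : Vertex N) → Dec (u ∼ w)
adj? u w = any? λ k →
  ((lookup u k ≟ inc5 (lookup w k)) ⊎-dec (lookup u k ≟ dec5 (lookup w k)))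
  ×-dec all? (λ j → ¬? (j ≟ k) →-dec (lookup u j ≟ lookup w j))

d : {N : ℕ} → Fin N → Vertex N → ℕ
d k v = lev (lookup v k)

countLev : {N : ℕ} → ℕ → Vertex N → ℕ
countLev m [] = 0
countLev m (x ∷ v) with lev x ℕ.≟ m
... | yes _ = suc (countLev m v)
... | no _ = countLev m v

-- v ∈ Σ_{a,b}  (indices are integers; empty when a < 0 or b < 0)
InΣ : {N : ℕ} → ℤ → ℤ → Vertex N → Set
InΣ a b v = (+ countLev 1 v ≡ a) × (+ countLev 2 v ≡ b)

inΣ? : {N : ℕ} (a b : ℤ) (v : Vertex N) → Dec (InΣ a b v)
inΣ? a b v = (+ countLev 1 v ℤ.≟ a) ×-dec (+ countLev 2 v ℤ.≟ b)

refl : {N : ℕ} → Fin N → Vertex N → Vertex N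
refl k v = v [ k ]≔ neg5 (lookup v k)

lowerAt : {N : ℕ} → Fin N → Vertex N → Vertex N
lowerAt k v = v [ k ]≔ lower5 (lookup v k)

module Ops {c ℓ : Level} (R : CommutativeRing c ℓ) where
  open CommutativeRing R public using (Carrier; _≈_; _+_; _-_; 0#)

  VFun : ℕ → Set c
  VFun N = Vertex N → Carrier

  sumL : {A : Set} → List A → (A → Carrier) → Carrier
  sumL [] g = 0#
  sumL (x ∷ xs) g = g x + sumL xs g

  sumIf : {A : Set} {P : A → Set} → List A → ((x : A) → Dec (P x)) → (A → Carrier) → Carrier
  sumIf xs P? g = sumL xs (λ x → if does (P? x) then g x else 0#)

  A : {N : ℕ} → (ℤ × ℤ) → (ℤ × ℤ) → VFun N → VFun N
  A {N} (a , b) (a' , b') g w =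
    if does (inΣ? a' b' w)
    then sumIf (allVertices N) (λ u → (inΣ? a b u) ×-dec (adj? u w)) g
    else 0#

  _⊖_ : {N : ℕ} → (VFun N → VFun N) → (VFun N → VFun N) → VFun N → VFun N
  (X ⊖ Y) f x = X f x - Y f x

  _∘ᵒ_ : {N : ℕ} → (VFun N → VFun N) → (VFun N → VFun N) → VFun N → VFun N
  (X ∘ᵒ Y) f = X (Y f)

  A0 : {N : ℕ} → VFun N → VFun N
  A0 {N} f v = sumIf (allFin N) (λ k → d k v ℕ.≟ 2) (λ k → f (refl k v))

  R1 : {N : ℕ} → VFun N → VFun N
  R1 {N} f v = sumIf (allFin N) (λ k → d k v ℕ.≟ 1) (λ k → f (refl k v))

  ρ : {N : ℕ} → Fin N → VFun N → VFun N
  ρ k h x = h (refl k x)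

  SupportedIn : {N : ℕ} → ℤ → ℤ → VFun N → Set ℓ
  SupportedIn p q f = ∀ x → ¬ InΣ p q x → f x ≈ 0#

-- For w ∈ Σ_{p-1,q+1}, both products in the commutator are double sums, over level-two
-- coordinates i and j of w, of f at w lowered at j and then reflected at i. They agree off the
-- diagonal i = j, which only A_{(p-1,q+1)→(p-1,q+1)} A_{(p,q)→(p-1,q+1)} sees: after lowering j
-- that coordinate has level one. So the commutator is the diagonal sum of f(ρ_j w_j^-).
-- Applying A_{(p-1,q+1)→(p,q)} at v raises a level-one coordinate k; the diagonal term j = k
-- gives R₁f(v), the others are cross terms f at v_j^- reflected at j and raised at k. Expanding
-- A_{(p,q)→(p+1,q-1)} f at ρ_ν v_ν^- gives the same cross terms, its diagonal k = ν giving A₀f(v).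
-- All operators read f on Σ_{p,q} only.

module Submission where

open import Defs
open import Level using (Level)
open import Data.Nat using (ℕ; _≤_)
open import Data.Integer using (ℤ; +_)
open import Data.Fin using (Fin)
open import Data.List using (allFin)
open import Data.Product using (_,_)
open import Algebra.Bundles using (CommutativeRing)

open import Data.Nat using (zero; suc)
import Data.Nat as ℕ
import Data.Nat.Properties as ℕP
open import Data.Nat.Solver using (module +-*-Solver)
import Data.Integer as ℤ
import Data.Integer.Properties as ℤP
open import Data.Fin using (zero; suc)
import Data.Fin as F
import Data.Fin.Properties as FP
open import Data.Vec using ([]; _∷_; lookup; _[_]≔_)
open import Data.Vec.Properties
  using (lookup∘update; lookup∘update′; []≔-idempotent; []≔-commutes; ≡-dec; tabulate∘lookup; tabulate-cong)
open import Data.List as List using (List; []; _∷_; _++_; concatMap)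
open import Data.Bool using (Bool; true; false; T; _∧_; _∨_; if_then_else_)
open import Data.Bool.Properties using (∧-comm)
open import Data.Product using (_×_)
open import Data.Sum using (inj₁; inj₂; [_,_])
open import Data.Empty using (⊥-elim)
open import Function using (_∘_; id; _⇔_; mk⇔; Equivalence)
open import Function.Properties.Equivalence using () renaming (trans to ⇔-trans)
open import Data.Product.Function.NonDependent.Propositional using (_×-⇔_)
open import Relation.Nullary using (Dec; yes; no; does)
open import Relation.Nullary.Decidable using (dec-true; dec-false; does-⇔; _×-dec_; T?)
open import Relation.Binary.Definitions using (DecidableEquality)
open import Relation.Binary.PropositionalEquality as ≡ using (_≡_; _≢_; cong; cong₂; sym; trans)
open import Algebra.Properties.AbelianGroup ℤP.+-0-abelianGroup
  using (∙-cancelʳ) renaming (//-rightDividesˡ to ℤ-//-rightDividesˡ)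

-- The inverse of lower5 on the level-one residues: ±1 ↦ ±2.
raise5 : Z5 → Z5
raise5 (suc zero) = suc (suc zero)
raise5 (suc (suc (suc (suc zero)))) = suc (suc (suc zero))
raise5 x = x

isLevel : ℕ → Z5 → Bool
isLevel m x = does (lev x ℕ.≟ m)

countLev₁ : ℕ → Z5 → ℕ
countLev₁ m x = countLev m (x ∷ [])

isLevel-≡ : ∀ {m} x → lev x ≡ m → isLevel m x ≡ true
isLevel-≡ x = dec-true (lev x ℕ.≟ _)

isLevel-≢ : ∀ {m n} x → lev x ≡ m → m ≢ n → isLevel n x ≡ false
isLevel-≢ x lev≡m m≢n = dec-false (lev x ℕ.≟ _) (λ lev≡n → m≢n (trans (sym lev≡m) lev≡n))

lev-neg5 : ∀ x → lev (neg5 x) ≡ lev x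
lev-neg5 zero = ≡.refl
lev-neg5 (suc zero) = ≡.refl
lev-neg5 (suc (suc zero)) = ≡.refl
lev-neg5 (suc (suc (suc zero))) = ≡.refl
lev-neg5 (suc (suc (suc (suc zero)))) = ≡.refl

lower5-neg5 : ∀ x → lower5 (neg5 x) ≡ neg5 (lower5 x)
lower5-neg5 zero = ≡.refl
lower5-neg5 (suc zero) = ≡.refl
lower5-neg5 (suc (suc zero)) = ≡.refl
lower5-neg5 (suc (suc (suc zero))) = ≡.refl
lower5-neg5 (suc (suc (suc (suc zero)))) = ≡.refl

lev-raise5 : ∀ x → lev x ≡ 1 → lev (raise5 x) ≡ 2
lev-raise5 (suc zero) _ = ≡.refl
lev-raise5 (suc (suc (suc (suc zero)))) _ = ≡.refl

lev-lower5 : ∀ x → lev x ≡ 2 → lev (lower5 x) ≡ 1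
lev-lower5 (suc (suc zero)) _ = ≡.refl
lev-lower5 (suc (suc (suc zero))) _ = ≡.refl
lev-lower5 (suc (suc (suc (suc zero)))) ()

lower5-raise5 : ∀ x → lev x ≡ 1 → lower5 (raise5 x) ≡ x
lower5-raise5 (suc zero) _ = ≡.refl
lower5-raise5 (suc (suc (suc (suc zero)))) _ = ≡.refl

raise5-neg5-lower5 : ∀ x → lev x ≡ 2 → raise5 (neg5 (lower5 x)) ≡ neg5 x
raise5-neg5-lower5 (suc (suc zero)) _ = ≡.refl
raise5-neg5-lower5 (suc (suc (suc zero))) _ = ≡.refl
raise5-neg5-lower5 (suc (suc (suc (suc zero)))) ()

inc5≢id : ∀ x → inc5 x ≢ x
inc5≢id zero ()
inc5≢id (suc zero) ()
inc5≢id (suc (suc zero)) ()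
inc5≢id (suc (suc (suc zero))) ()
inc5≢id (suc (suc (suc (suc zero)))) ()

dec5≢id : ∀ x → dec5 x ≢ x
dec5≢id zero ()
dec5≢id (suc zero) ()
dec5≢id (suc (suc zero)) ()
dec5≢id (suc (suc (suc zero))) ()
dec5≢id (suc (suc (suc (suc zero)))) ()

inc5≢dec5 : ∀ x → inc5 x ≢ dec5 x
inc5≢dec5 zero ()
inc5≢dec5 (suc zero) ()
inc5≢dec5 (suc (suc zero)) ()
inc5≢dec5 (suc (suc (suc zero))) ()
inc5≢dec5 (suc (suc (suc (suc zero)))) ()

mapAt : ∀ {N} → (Z5 → Z5) → Fin N → Vertex N → Vertex N
mapAt f k w = w [ k ]≔ f (lookup w k)

module _ {N : ℕ} (w : Vertex N) where

  lookup-mapAt : ∀ f k → lookup (mapAt f k w) k ≡ f (lookup w k)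
  lookup-mapAt f k = lookup∘update k w _

  lookup-mapAt-≢ : ∀ f {i k} → i ≢ k → lookup (mapAt f k w) i ≡ lookup w i
  lookup-mapAt-≢ f i≢k = lookup∘update′ i≢k w _

  mapAt-mapAt : ∀ f g e k → f (g (lookup w k)) ≡ e (lookup w k) → mapAt f k (mapAt g k w) ≡ mapAt e k w
  mapAt-mapAt f g e k fg≡e = trans (cong (λ y → mapAt g k w [ k ]≔ f y) (lookup-mapAt g k))
                                   (trans ([]≔-idempotent w k) (cong (w [ k ]≔_) fg≡e))

  mapAt-comm : ∀ f g {i j} → i ≢ j → mapAt f i (mapAt g j w) ≡ mapAt g j (mapAt f i w)
  mapAt-comm f g {i} {j} i≢j = begin
    (w [ j ]≔ g (lookup w j)) [ i ]≔ f (lookup (mapAt g j w) i)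
      ≡⟨ cong (λ y → mapAt g j w [ i ]≔ f y) (lookup-mapAt-≢ g i≢j) ⟩
    (w [ j ]≔ g (lookup w j)) [ i ]≔ f (lookup w i)
      ≡⟨ []≔-commutes w j i (i≢j ∘ sym) ⟩
    (w [ i ]≔ f (lookup w i)) [ j ]≔ g (lookup w j)
      ≡⟨ cong (λ y → mapAt f i w [ j ]≔ g y) (lookup-mapAt-≢ f (i≢j ∘ sym)) ⟨
    (w [ i ]≔ f (lookup w i)) [ j ]≔ g (lookup (mapAt f i w) j) ∎
    where open ≡.≡-Reasoning

-- Level counts under a single-coordinate change

countLev-∷ : ∀ {N} m x (w : Vertex N) → countLev m (x ∷ w) ≡ countLev₁ m x ℕ.+ countLev m w
countLev-∷ m x w with lev x ℕ.≟ m
... | yes _ = ≡.refl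
... | no _ = ≡.refl

countLev-[]≔ : ∀ {N} m (w : Vertex N) k y →
  countLev m (w [ k ]≔ y) ℕ.+ countLev₁ m (lookup w k) ≡ countLev m w ℕ.+ countLev₁ m y
countLev-[]≔ m (x ∷ w) zero y = begin
  countLev m (y ∷ w) ℕ.+ countLev₁ m x      ≡⟨ cong (ℕ._+ countLev₁ m x) (countLev-∷ m y w) ⟩
  countLev₁ m y ℕ.+ countLev m w ℕ.+ countLev₁ m x
    ≡⟨ solve 3 (λ a b c → a :+ b :+ c := c :+ b :+ a) ≡.refl (countLev₁ m y) (countLev m w) (countLev₁ m x) ⟩
  countLev₁ m x ℕ.+ countLev m w ℕ.+ countLev₁ m y ≡⟨ cong (ℕ._+ countLev₁ m y) (countLev-∷ m x w) ⟨
  countLev m (x ∷ w) ℕ.+ countLev₁ m y      ∎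
  where open ≡.≡-Reasoning; open +-*-Solver
countLev-[]≔ m (x ∷ w) (suc k) y = begin
  countLev m (x ∷ (w [ k ]≔ y)) ℕ.+ countLev₁ m (lookup w k)
    ≡⟨ cong (ℕ._+ countLev₁ m (lookup w k)) (countLev-∷ m x (w [ k ]≔ y)) ⟩
  countLev₁ m x ℕ.+ countLev m (w [ k ]≔ y) ℕ.+ countLev₁ m (lookup w k)
    ≡⟨ ℕP.+-assoc (countLev₁ m x) _ _ ⟩
  countLev₁ m x ℕ.+ (countLev m (w [ k ]≔ y) ℕ.+ countLev₁ m (lookup w k))
    ≡⟨ cong (countLev₁ m x ℕ.+_) (countLev-[]≔ m w k y) ⟩
  countLev₁ m x ℕ.+ (countLev m w ℕ.+ countLev₁ m y)
    ≡⟨ ℕP.+-assoc (countLev₁ m x) _ _ ⟨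
  countLev₁ m x ℕ.+ countLev m w ℕ.+ countLev₁ m y
    ≡⟨ cong (ℕ._+ countLev₁ m y) (countLev-∷ m x w) ⟨
  countLev m (x ∷ w) ℕ.+ countLev₁ m y ∎
  where open ≡.≡-Reasoning

ℕ-offset-⇔ : ∀ {c c' i j δ ε} → c' ℕ.+ i ≡ c ℕ.+ j →
             (c' ℕ.+ δ ≡ c ℕ.+ ε) ⇔ (δ ℕ.+ j ≡ ε ℕ.+ i)
ℕ-offset-⇔ {c} {c'} {i} {j} {δ} {ε} c'+i≡c+j = mk⇔ to from
  where
  open ≡.≡-Reasoning
  open +-*-Solver
  to : c' ℕ.+ δ ≡ c ℕ.+ ε → δ ℕ.+ j ≡ ε ℕ.+ i
  to eq = ℕP.+-cancelˡ-≡ c _ _ (begin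
    c ℕ.+ (δ ℕ.+ j)    ≡⟨ solve 3 (λ c δ j → c :+ (δ :+ j) := c :+ j :+ δ) ≡.refl c δ j ⟩
    c ℕ.+ j ℕ.+ δ      ≡⟨ cong (ℕ._+ δ) c'+i≡c+j ⟨
    c' ℕ.+ i ℕ.+ δ     ≡⟨ solve 3 (λ c' i δ → c' :+ i :+ δ := c' :+ δ :+ i) ≡.refl c' i δ ⟩
    c' ℕ.+ δ ℕ.+ i     ≡⟨ cong (ℕ._+ i) eq ⟩
    c ℕ.+ ε ℕ.+ i      ≡⟨ ℕP.+-assoc c ε i ⟩
    c ℕ.+ (ε ℕ.+ i)    ∎)
  from : δ ℕ.+ j ≡ ε ℕ.+ i → c' ℕ.+ δ ≡ c ℕ.+ ε
  from eq = ℕP.+-cancelʳ-≡ i _ _ (begin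
    c' ℕ.+ δ ℕ.+ i     ≡⟨ solve 3 (λ c' δ i → c' :+ δ :+ i := c' :+ i :+ δ) ≡.refl c' δ i ⟩
    c' ℕ.+ i ℕ.+ δ     ≡⟨ cong (ℕ._+ δ) c'+i≡c+j ⟩
    c ℕ.+ j ℕ.+ δ      ≡⟨ solve 3 (λ c j δ → c :+ j :+ δ := c :+ (δ :+ j)) ≡.refl c j δ ⟩
    c ℕ.+ (δ ℕ.+ j)    ≡⟨ cong (c ℕ.+_) eq ⟩
    c ℕ.+ (ε ℕ.+ i)    ≡⟨ ℕP.+-assoc c ε i ⟨
    c ℕ.+ ε ℕ.+ i      ∎)

ℤ-offset-⇔ : ∀ {a a' : ℤ} {c c' δ ε} → a ℤ.+ + δ ≡ a' ℤ.+ + ε → + c ≡ a' →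
            (+ c' ≡ a) ⇔ (c' ℕ.+ δ ≡ c ℕ.+ ε)
ℤ-offset-⇔ {a} {a'} {c} {c'} {δ} {ε} a+δ≡a'+ε c≡a' = mk⇔ to from
  where
  open ≡.≡-Reasoning
  c+ε≡a+δ : + (c ℕ.+ ε) ≡ a ℤ.+ + δ
  c+ε≡a+δ = begin
    + (c ℕ.+ ε)    ≡⟨ ℤP.pos-+ c ε ⟩
    + c ℤ.+ + ε    ≡⟨ cong (ℤ._+ + ε) c≡a' ⟩
    a' ℤ.+ + ε     ≡⟨ a+δ≡a'+ε ⟨
    a ℤ.+ + δ      ∎
  to : + c' ≡ a → c' ℕ.+ δ ≡ c ℕ.+ ε
  to c'≡a = ℤP.+-injective (trans (ℤP.pos-+ c' δ) (trans (cong (ℤ._+ + δ) c'≡a) (sym c+ε≡a+δ)))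
  from : c' ℕ.+ δ ≡ c ℕ.+ ε → + c' ≡ a
  from eq = ∙-cancelʳ (+ δ) (+ c') a (trans (sym (ℤP.pos-+ c' δ)) (trans (cong +_ eq) c+ε≡a+δ))

count-offset-⇔ : ∀ {a a' : ℤ} {c c' i j δ ε} → a ℤ.+ + δ ≡ a' ℤ.+ + ε → + c ≡ a' →
                 c' ℕ.+ i ≡ c ℕ.+ j → (+ c' ≡ a) ⇔ (δ ℕ.+ j ≡ ε ℕ.+ i)
count-offset-⇔ {δ = δ} {ε} ha hc hu = ⇔-trans (ℤ-offset-⇔ ha hc) (ℕ-offset-⇔ {δ = δ} {ε} hu)

-- Replacing the coordinate x by y takes Σ_{a',b'} to Σ_{a,b} iff a - a' = ε₁ - δ₁ and
-- b - b' = ε₂ - δ₂ (InΣ-[]≔); the offsets are split into naturals so that the test computes.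
LevelShift : ℕ → ℕ → ℕ → ℕ → Z5 → Z5 → Set
LevelShift δ₁ ε₁ δ₂ ε₂ x y = (δ₁ ℕ.+ countLev₁ 1 y ≡ ε₁ ℕ.+ countLev₁ 1 x)
                           × (δ₂ ℕ.+ countLev₁ 2 y ≡ ε₂ ℕ.+ countLev₁ 2 x)

levelShift? : ∀ δ₁ ε₁ δ₂ ε₂ x y → Dec (LevelShift δ₁ ε₁ δ₂ ε₂ x y)
levelShift? δ₁ ε₁ δ₂ ε₂ x y = (_ ℕ.≟ _) ×-dec (_ ℕ.≟ _)

InΣ-[]≔ : ∀ {N} {a b a' b' : ℤ} {δ₁ ε₁ δ₂ ε₂} →
          a ℤ.+ + δ₁ ≡ a' ℤ.+ + ε₁ → b ℤ.+ + δ₂ ≡ b' ℤ.+ + ε₂ →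
          (w : Vertex N) → InΣ a' b' w → ∀ k y →
          InΣ a b (w [ k ]≔ y) ⇔ LevelShift δ₁ ε₁ δ₂ ε₂ (lookup w k) y
InΣ-[]≔ ha hb w (c₁≡a' , c₂≡b') k y =
  count-offset-⇔ ha c₁≡a' (countLev-[]≔ 1 w k y) ×-⇔ count-offset-⇔ hb c₂≡b' (countLev-[]≔ 2 w k y)

neg5-shift : ∀ x → LevelShift 0 0 0 0 x (neg5 x)
neg5-shift zero = ≡.refl , ≡.refl
neg5-shift (suc zero) = ≡.refl , ≡.refl
neg5-shift (suc (suc zero)) = ≡.refl , ≡.refl
neg5-shift (suc (suc (suc zero))) = ≡.refl , ≡.refl
neg5-shift (suc (suc (suc (suc zero)))) = ≡.refl , ≡.refl

raise5-shift : ∀ x → lev x ≡ 1 → LevelShift 1 0 0 1 x (raise5 x)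
raise5-shift (suc zero) _ = ≡.refl , ≡.refl
raise5-shift (suc (suc (suc (suc zero)))) _ = ≡.refl , ≡.refl

lower5-shift : ∀ x → lev x ≡ 2 → LevelShift 0 1 1 0 x (lower5 x)
lower5-shift (suc (suc zero)) _ = ≡.refl , ≡.refl
lower5-shift (suc (suc (suc zero))) _ = ≡.refl , ≡.refl
lower5-shift (suc (suc (suc (suc zero)))) ()

refl-InΣ : ∀ {N} {a b : ℤ} (w : Vertex N) → InΣ a b w → ∀ k → InΣ a b (refl k w)
refl-InΣ w hw k = Equivalence.from (InΣ-[]≔ ≡.refl ≡.refl w hw k _) (neg5-shift (lookup w k))

module _ {N : ℕ} {a b a' b' : ℤ} where

  raise-InΣ : a ℤ.+ + 1 ≡ a' → b ≡ b' ℤ.+ + 1 → (w : Vertex N) → InΣ a' b' w →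
              ∀ {k} → lev (lookup w k) ≡ 1 → InΣ a b (mapAt raise5 k w)
  raise-InΣ ha hb w hw {k} l =
    Equivalence.from (InΣ-[]≔ (trans ha (sym (ℤP.+-identityʳ a'))) (trans (ℤP.+-identityʳ b) hb) w hw k _)
                     (raise5-shift _ l)

  lower-InΣ : a ≡ a' ℤ.+ + 1 → b ℤ.+ + 1 ≡ b' → (w : Vertex N) → InΣ a' b' w →
              ∀ {k} → lev (lookup w k) ≡ 2 → InΣ a b (lowerAt k w)
  lower-InΣ ha hb w hw {k} l =
    Equivalence.from (InΣ-[]≔ (trans (ℤP.+-identityʳ a) ha) (trans hb (sym (ℤP.+-identityʳ b'))) w hw k _)
                     (lower5-shift _ l)

_≟ᵥ_ : ∀ {n} → DecidableEquality (Vertex n)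
_≟ᵥ_ = ≡-dec F._≟_

lookup-injective : ∀ {n} {u w : Vertex n} → (∀ j → lookup u j ≡ lookup w j) → u ≡ w
lookup-injective {u = u} {w} eq = trans (sym (tabulate∘lookup u)) (trans (tabulate-cong eq) (tabulate∘lookup w))

-- Structurally recursive, so that sums over allVertices can be unfolded along it.
adjacentᵇ : ∀ {n} → Vertex n → Vertex n → Bool
adjacentᵇ [] [] = false
adjacentᵇ (x ∷ u) (y ∷ w) =
  if does (x F.≟ y) then adjacentᵇ u w
  else (does (x F.≟ inc5 y) ∨ does (x F.≟ dec5 y)) ∧ does (u ≟ᵥ w)

adjacentᵇ-sound : ∀ {n} (u w : Vertex n) → T (adjacentᵇ u w) → u ∼ w
adjacentᵇ-sound [] [] ()
adjacentᵇ-sound (x ∷ u) (y ∷ w) h with x F.≟ y | x F.≟ inc5 y | x F.≟ dec5 y | u ≟ᵥ w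
... | yes ≡.refl | _ | _ | _ =
  let k , step , same = adjacentᵇ-sound u w h
  in suc k , step , λ { zero _ → ≡.refl ; (suc j) j≢k → same j (j≢k ∘ cong suc) }
... | no _ | yes x≡y⁺ | _ | yes ≡.refl = zero , inj₁ x≡y⁺ , tailsAgree
  where tailsAgree = λ { zero 0≢0 → ⊥-elim (0≢0 ≡.refl) ; (suc j) _ → ≡.refl }
... | no _ | no _ | yes x≡y⁻ | yes ≡.refl = zero , inj₂ x≡y⁻ , tailsAgree
  where tailsAgree = λ { zero 0≢0 → ⊥-elim (0≢0 ≡.refl) ; (suc j) _ → ≡.refl }
... | no _ | yes _ | _ | no _ = ⊥-elim h
... | no _ | no _ | yes _ | no _ = ⊥-elim h
... | no _ | no _ | no _ | _ = ⊥-elim h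

adjacentᵇ-complete : ∀ {n} (u w : Vertex n) → u ∼ w → T (adjacentᵇ u w)
adjacentᵇ-complete (x ∷ u) (y ∷ w) (zero , step , same)
  with ≡.refl ← lookup-injective {u = u} {w} (λ j → same (suc j) λ ())
  with x F.≟ y | x F.≟ inc5 y | x F.≟ dec5 y | u ≟ᵥ u
... | yes ≡.refl | _ | _ | _ = ⊥-elim ([ inc5≢id x ∘ sym , dec5≢id x ∘ sym ] step)
... | no _ | _ | _ | no u≢u = ⊥-elim (u≢u ≡.refl)
... | no _ | yes _ | _ | yes _ = _
... | no _ | no _ | yes _ | yes _ = _
... | no _ | no x≢y⁺ | no x≢y⁻ | yes _ = ⊥-elim ([ x≢y⁺ , x≢y⁻ ] step)
adjacentᵇ-complete (x ∷ u) (y ∷ w) (suc k , step , same) with x F.≟ y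
... | yes ≡.refl = adjacentᵇ-complete u w (k , step , λ j j≢k → same (suc j) (j≢k ∘ FP.suc-injective))
... | no x≢y = ⊥-elim (x≢y (same zero λ ()))

does-adj? : ∀ {n} (u w : Vertex n) → does (adj? u w) ≡ adjacentᵇ u w
does-adj? u w = does-⇔ (mk⇔ (adjacentᵇ-complete u w) (adjacentᵇ-sound u w)) (adj? u w) (T? (adjacentᵇ u w))

module _ {N : ℕ} (w : Vertex N) where

  lev-refl : ∀ i j → lev (lookup (refl i w) j) ≡ lev (lookup w j)
  lev-refl i j with j F.≟ i
  ... | yes ≡.refl = trans (cong lev (lookup-mapAt w neg5 j)) (lev-neg5 (lookup w j))
  ... | no j≢i = cong lev (lookup-mapAt-≢ w neg5 j≢i)

  lowerAt-refl : ∀ i j → lowerAt j (refl i w) ≡ refl i (lowerAt j w)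
  lowerAt-refl i j with j F.≟ i
  ... | yes ≡.refl = trans (mapAt-mapAt w lower5 neg5 (neg5 ∘ lower5) j (lower5-neg5 (lookup w j)))
                           (sym (mapAt-mapAt w neg5 lower5 (neg5 ∘ lower5) j ≡.refl))
  ... | no j≢i = mapAt-comm w lower5 neg5 j≢i

  refl-lowerAt-raise : ∀ k → lev (lookup w k) ≡ 1 → refl k (lowerAt k (mapAt raise5 k w)) ≡ refl k w
  refl-lowerAt-raise k l = trans (cong (mapAt neg5 k) (mapAt-mapAt w lower5 raise5 (lower5 ∘ raise5) k ≡.refl))
                                 (mapAt-mapAt w neg5 (lower5 ∘ raise5) neg5 k (cong neg5 (lower5-raise5 _ l)))

  raise-refl-lowerAt : ∀ k → lev (lookup w k) ≡ 2 → mapAt raise5 k (refl k (lowerAt k w)) ≡ refl k w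
  raise-refl-lowerAt k l = trans (cong (mapAt raise5 k) (mapAt-mapAt w neg5 lower5 (neg5 ∘ lower5) k ≡.refl))
                                 (mapAt-mapAt w raise5 (neg5 ∘ lower5) neg5 k (raise5-neg5-lower5 _ l))

  refl-lowerAt-raise-≢ : ∀ {j k} → j ≢ k →
                         refl j (lowerAt j (mapAt raise5 k w)) ≡ mapAt raise5 k (refl j (lowerAt j w))
  refl-lowerAt-raise-≢ j≢k = trans (cong (mapAt neg5 _) (mapAt-comm w lower5 raise5 j≢k))
                                   (mapAt-comm (lowerAt _ w) neg5 raise5 j≢k)

module _ {c ℓ : Level} (R : CommutativeRing c ℓ) where
  open Ops R
  open CommutativeRing R
    using (setoid; +-cong; +-congˡ; +-congʳ; +-assoc; +-comm; +-identityˡ; +-identityʳ; -_; -‿cong;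
           +-commutativeMonoid; +-commutativeSemigroup; +-abelianGroup)
    renaming (refl to ≈-refl; sym to ≈-sym; trans to ≈-trans; reflexive to ≈-reflexive)
  open import Algebra.Properties.CommutativeMonoid.Sum +-commutativeMonoid
    using (sum; sum-syntax; ∑-distrib-+; ∑-comm; sum-cong-≋; sum-replicate-zero)
  open import Algebra.Properties.CommutativeSemigroup +-commutativeSemigroup using (interchange; x∙yz≈y∙xz)
  open import Relation.Binary.Reasoning.Setoid setoid

  -- Finite sums

  when : Bool → Carrier → Carrier
  when b t = if b then t else 0#

  when-cong : ∀ b {s t} → s ≈ t → when b s ≈ when b t
  when-cong true s≈t = s≈t
  when-cong false _ = ≈-refl

  when-does-cong : ∀ {a} {A : Set a} (a? : Dec A) {s t} → (A → s ≈ t) → when (does a?) s ≈ when (does a?) t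
  when-does-cong (yes a) s≈t = s≈t a
  when-does-cong (no _) _ = ≈-refl

  when-0# : ∀ b → when b 0# ≈ 0#
  when-0# true = ≈-refl
  when-0# false = ≈-refl

  when-+ : ∀ b s t → when b (s + t) ≈ when b s + when b t
  when-+ true s t = ≈-refl
  when-+ false s t = ≈-sym (+-identityˡ 0#)

  when-∧ : ∀ a b t → when (a ∧ b) t ≡ when a (when b t)
  when-∧ true b t = ≡.refl
  when-∧ false b t = ≡.refl

  when-comm : ∀ a b t → when a (when b t) ≡ when b (when a t)
  when-comm a b t = trans (sym (when-∧ a b t)) (trans (cong (λ β → when β t) (∧-comm a b)) (when-∧ b a t))

  when-idem : ∀ b t → when b (when b t) ≈ when b t
  when-idem true t = ≈-refl
  when-idem false t = ≈-refl

  ∑-when : ∀ b {n} (h : Fin n → Carrier) → when b (∑[ i < n ] h i) ≈ ∑[ i < n ] when b (h i)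
  ∑-when true h = ≈-refl
  ∑-when false {n} h = ≈-sym (sum-replicate-zero n)

  ∑-when-+-∑ : ∀ {m n} (b : Fin m → Bool) (s : Fin m → Carrier) (t : Fin m → Fin n → Carrier) →
    ∑[ k < m ] when (b k) (s k + ∑[ j < n ] t k j)
      ≈ ∑[ k < m ] when (b k) (s k) + ∑[ k < m ] ∑[ j < n ] when (b k) (t k j)
  ∑-when-+-∑ {n = n} b s t = ≈-trans (sum-cong-≋ λ k → ≈-trans (when-+ (b k) _ _) (+-congˡ (∑-when (b k) (t k))))
                             (∑-distrib-+ (λ k → when (b k) (s k)) (λ k → ∑[ j < n ] when (b k) (t k j)))

  ∑-extract : ∀ {n} (k : Fin n) {t s : Fin n → Carrier} {x} →
              t k ≈ x → s k ≈ 0# → (∀ j → j ≢ k → t j ≈ s j) → sum t ≈ x + sum s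
  ∑-extract zero {t} {s} {x} tₖ sₖ tⱼ = begin
    t zero + sum (t ∘ suc)        ≈⟨ +-cong tₖ (sum-cong-≋ (λ j → tⱼ (suc j) λ ())) ⟩
    x + sum (s ∘ suc)             ≈⟨ +-congˡ (+-identityˡ _) ⟨
    x + (0# + sum (s ∘ suc))      ≈⟨ +-congˡ (+-congʳ sₖ) ⟨
    x + sum s                     ∎
  ∑-extract (suc k) {t} {s} {x} tₖ sₖ tⱼ = begin
    t zero + sum (t ∘ suc)
      ≈⟨ +-cong (tⱼ zero λ ()) (∑-extract k tₖ sₖ (λ j j≢k → tⱼ (suc j) (j≢k ∘ FP.suc-injective))) ⟩
    s zero + (x + sum (s ∘ suc))  ≈⟨ x∙yz≈y∙xz (s zero) x _ ⟩
    x + sum s                     ∎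

  ∑-δ : ∀ {n} (j : Fin n) (h : Fin n → Carrier) → ∑[ i < n ] when (does (i F.≟ j)) (h i) ≈ h j
  ∑-δ {n} j h = begin
    ∑[ i < n ] when (does (i F.≟ j)) (h i) ≈⟨ ∑-extract j diagonal ≈-refl offDiagonal ⟩
    h j + ∑[ i < n ] 0#                  ≈⟨ +-congˡ (sum-replicate-zero n) ⟩
    h j + 0#                             ≈⟨ +-identityʳ (h j) ⟩
    h j                                  ∎
    where
    diagonal : when (does (j F.≟ j)) (h j) ≈ h j
    diagonal = ≈-reflexive (cong (λ b → when b (h j)) (dec-true (j F.≟ j) ≡.refl))
    offDiagonal : ∀ i → i ≢ j → when (does (i F.≟ j)) (h i) ≈ 0#
    offDiagonal i i≢j = ≈-reflexive (cong (λ b → when b (h i)) (dec-false (i F.≟ j) i≢j))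

  sumL-cong : ∀ {X : Set} (xs : List X) {h g} → (∀ x → h x ≈ g x) → sumL xs h ≈ sumL xs g
  sumL-cong [] _ = ≈-refl
  sumL-cong (x ∷ xs) h≈g = +-cong (h≈g x) (sumL-cong xs h≈g)

  sumL-++ : ∀ {X : Set} (xs ys : List X) h → sumL (xs ++ ys) h ≈ sumL xs h + sumL ys h
  sumL-++ [] ys h = ≈-sym (+-identityˡ _)
  sumL-++ (x ∷ xs) ys h = ≈-trans (+-congˡ (sumL-++ xs ys h)) (≈-sym (+-assoc _ _ _))

  sumL-+ : ∀ {X : Set} (xs : List X) h g → sumL xs (λ x → h x + g x) ≈ sumL xs h + sumL xs g
  sumL-+ [] h g = ≈-sym (+-identityˡ 0#)
  sumL-+ (x ∷ xs) h g = ≈-trans (+-congˡ (sumL-+ xs h g)) (interchange _ _ _ _)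

  sumL-when : ∀ {X : Set} (xs : List X) b h → sumL xs (λ x → when b (h x)) ≈ when b (sumL xs h)
  sumL-when xs true h = ≈-refl
  sumL-when [] false h = ≈-refl
  sumL-when (x ∷ xs) false h = ≈-trans (+-congˡ (sumL-when xs false h)) (+-identityˡ 0#)

  sumL-concatMap : ∀ {X Y : Set} (f : X → List Y) xs h → sumL (concatMap f xs) h ≈ sumL xs (λ x → sumL (f x) h)
  sumL-concatMap f [] h = ≈-refl
  sumL-concatMap f (x ∷ xs) h = ≈-trans (sumL-++ (f x) (concatMap f xs) h) (+-congˡ (sumL-concatMap f xs h))

  sumL-map : ∀ {X Y : Set} (f : Y → X) ys h → sumL (List.map f ys) h ≡ sumL ys (h ∘ f)
  sumL-map f [] h = ≡.refl
  sumL-map f (y ∷ ys) h = cong (_+_ (h (f y))) (sumL-map f ys h)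

  sumL-tabulate : ∀ {X : Set} {n} (f : Fin n → X) h → sumL (List.tabulate f) h ≡ ∑[ i < n ] h (f i)
  sumL-tabulate {n = zero} f h = ≡.refl
  sumL-tabulate {n = suc n} f h = cong (_+_ (h (f zero))) (sumL-tabulate (f ∘ suc) h)

  sumIf-allFin : ∀ {n} {P : Fin n → Set} (P? : ∀ k → Dec (P k)) h →
                 sumIf (allFin n) P? h ≡ ∑[ k < n ] when (does (P? k)) (h k)
  sumIf-allFin P? h = sumL-tabulate id (λ k → when (does (P? k)) (h k))

  sumL-allZ5-δ : ∀ z (h : Z5 → Carrier) → sumL allZ5 (λ x → when (does (x F.≟ z)) (h x)) ≈ h z
  sumL-allZ5-δ z h = ≈-trans (≈-reflexive (sumL-tabulate id (λ x → when (does (x F.≟ z)) (h x)))) (∑-δ z h)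

  sumL-allVertices-∷ : ∀ n (h : Vertex (suc n) → Carrier) →
                       sumL (allVertices (suc n)) h ≈ sumL allZ5 (λ x → sumL (allVertices n) (λ u → h (x ∷ u)))
  sumL-allVertices-∷ n h = ≈-trans (sumL-concatMap (λ x → List.map (x ∷_) (allVertices n)) allZ5 h)
                                   (sumL-cong allZ5 (λ x → ≈-reflexive (sumL-map (x ∷_) (allVertices n) h)))

  sumL-allVertices-δ : ∀ {n} (w : Vertex n) (h : Vertex n → Carrier) →
                       sumL (allVertices n) (λ u → when (does (u ≟ᵥ w)) (h u)) ≈ h w
  sumL-allVertices-δ [] h = +-identityʳ (h [])
  sumL-allVertices-δ {suc n} (y ∷ w) h = begin
    sumL (allVertices (suc n)) (λ u → when (does (u ≟ᵥ (y ∷ w))) (h u))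
      ≈⟨ sumL-allVertices-∷ n _ ⟩
    sumL allZ5 (λ x → sumL (allVertices n) (λ u → when (does (x F.≟ y) ∧ does (u ≟ᵥ w)) (h (x ∷ u))))
      ≈⟨ sumL-cong allZ5 (λ x → begin
           sumL (allVertices n) (λ u → when (does (x F.≟ y) ∧ does (u ≟ᵥ w)) (h (x ∷ u)))
             ≈⟨ sumL-cong (allVertices n) (λ u → ≈-reflexive (when-∧ (does (x F.≟ y)) _ (h (x ∷ u)))) ⟩
           sumL (allVertices n) (λ u → when (does (x F.≟ y)) (when (does (u ≟ᵥ w)) (h (x ∷ u))))
             ≈⟨ sumL-when (allVertices n) _ _ ⟩
           when (does (x F.≟ y)) (sumL (allVertices n) (λ u → when (does (u ≟ᵥ w)) (h (x ∷ u))))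
             ≈⟨ when-cong _ (sumL-allVertices-δ w (h ∘ (x ∷_))) ⟩
           when (does (x F.≟ y)) (h (x ∷ w)) ∎) ⟩
    sumL allZ5 (λ x → when (does (x F.≟ y)) (h (x ∷ w)))
      ≈⟨ sumL-allZ5-δ y (λ x → h (x ∷ w)) ⟩
    h (y ∷ w) ∎

  -- Subadjacency operators

  when-adjacentᵇ-∷ : ∀ {n} x y (u w : Vertex n) t →
    when (adjacentᵇ (x ∷ u) (y ∷ w)) t
      ≈ when (does (x F.≟ y)) (when (adjacentᵇ u w) t)
        + (when (does (x F.≟ inc5 y)) (when (does (u ≟ᵥ w)) t)
           + when (does (x F.≟ dec5 y)) (when (does (u ≟ᵥ w)) t))
  when-adjacentᵇ-∷ x y u w t with x F.≟ y | x F.≟ inc5 y | x F.≟ dec5 y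
  ... | yes ≡.refl | yes x≡x⁺ | _          = ⊥-elim (inc5≢id x (sym x≡x⁺))
  ... | yes ≡.refl | no _     | yes x≡x⁻   = ⊥-elim (dec5≢id x (sym x≡x⁻))
  ... | no _       | yes ≡.refl | yes y⁺≡y⁻ = ⊥-elim (inc5≢dec5 y y⁺≡y⁻)
  ... | yes ≡.refl | no _     | no _       = ≈-sym (≈-trans (+-congˡ (+-identityˡ 0#)) (+-identityʳ _))
  ... | no _       | yes _    | no _       = ≈-sym (≈-trans (+-identityˡ _) (+-identityʳ _))
  ... | no _       | no _     | yes _      = ≈-sym (≈-trans (+-identityˡ _) (+-identityˡ _))
  ... | no _       | no _     | no _       = ≈-sym (≈-trans (+-identityˡ _) (+-identityˡ 0#))

  sumL-adjacent : ∀ {n} (w : Vertex n) (g : Vertex n → Carrier) →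
    sumL (allVertices n) (λ u → when (adjacentᵇ u w) (g u)) ≈ ∑[ k < n ] (g (mapAt inc5 k w) + g (mapAt dec5 k w))
  sumL-adjacent [] g = +-identityˡ 0#
  sumL-adjacent {suc n} (y ∷ w) g = begin
    sumL (allVertices (suc n)) (λ u → when (adjacentᵇ u (y ∷ w)) (g u))
      ≈⟨ sumL-allVertices-∷ n _ ⟩
    sumL allZ5 (λ x → sumL (allVertices n) (λ u → when (adjacentᵇ (x ∷ u) (y ∷ w)) (g (x ∷ u))))
      ≈⟨ sumL-cong allZ5 split ⟩
    sumL allZ5 (λ x → stay x + (up x + down x))
      ≈⟨ ≈-trans (sumL-+ allZ5 stay (λ x → up x + down x)) (+-congˡ (sumL-+ allZ5 up down)) ⟩
    sumL allZ5 stay + (sumL allZ5 up + sumL allZ5 down)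
      ≈⟨ +-cong (sumL-allZ5-δ y viaTail) (+-cong (sumL-allZ5-δ (inc5 y) viaHead) (sumL-allZ5-δ (dec5 y) viaHead)) ⟩
    viaTail y + (viaHead (inc5 y) + viaHead (dec5 y))
      ≈⟨ +-cong (sumL-adjacent w (g ∘ (y ∷_)))
                (+-cong (sumL-allVertices-δ w (g ∘ (inc5 y ∷_))) (sumL-allVertices-δ w (g ∘ (dec5 y ∷_)))) ⟩
    ∑[ k < n ] (g (y ∷ mapAt inc5 k w) + g (y ∷ mapAt dec5 k w)) + (g (inc5 y ∷ w) + g (dec5 y ∷ w))
      ≈⟨ +-comm _ _ ⟩
    ∑[ k < suc n ] (g (mapAt inc5 k (y ∷ w)) + g (mapAt dec5 k (y ∷ w))) ∎
    where
    viaTail viaHead stay up down : Z5 → Carrier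
    viaTail x = sumL (allVertices n) (λ u → when (adjacentᵇ u w) (g (x ∷ u)))
    viaHead x = sumL (allVertices n) (λ u → when (does (u ≟ᵥ w)) (g (x ∷ u)))
    stay x = when (does (x F.≟ y)) (viaTail x)
    up x = when (does (x F.≟ inc5 y)) (viaHead x)
    down x = when (does (x F.≟ dec5 y)) (viaHead x)
    split : ∀ x → sumL (allVertices n) (λ u → when (adjacentᵇ (x ∷ u) (y ∷ w)) (g (x ∷ u)))
                  ≈ stay x + (up x + down x)
    split x = begin
      sumL (allVertices n) (λ u → when (adjacentᵇ (x ∷ u) (y ∷ w)) (g (x ∷ u)))
        ≈⟨ sumL-cong (allVertices n) (λ u → when-adjacentᵇ-∷ x y u w (g (x ∷ u))) ⟩
      sumL (allVertices n) (λ u → stay′ u + (up′ u + down′ u))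
        ≈⟨ ≈-trans (sumL-+ (allVertices n) stay′ (λ u → up′ u + down′ u))
                   (+-congˡ (sumL-+ (allVertices n) up′ down′)) ⟩
      sumL (allVertices n) stay′ + (sumL (allVertices n) up′ + sumL (allVertices n) down′)
        ≈⟨ +-cong (sumL-when (allVertices n) _ _)
                  (+-cong (sumL-when (allVertices n) _ _) (sumL-when (allVertices n) _ _)) ⟩
      stay x + (up x + down x) ∎
      where
      stay′ up′ down′ : Vertex n → Carrier
      stay′ u = when (does (x F.≟ y)) (when (adjacentᵇ u w) (g (x ∷ u)))
      up′ u = when (does (x F.≟ inc5 y)) (when (does (u ≟ᵥ w)) (g (x ∷ u)))
      down′ u = when (does (x F.≟ dec5 y)) (when (does (u ≟ᵥ w)) (g (x ∷ u)))

  A-neighbours : ∀ {N} {a b a' b' : ℤ} (g : VFun N) (w : Vertex N) → InΣ a' b' w →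
    A (a , b) (a' , b') g w
      ≈ ∑[ k < N ] (when (does (inΣ? a b (mapAt inc5 k w))) (g (mapAt inc5 k w))
                    + when (does (inΣ? a b (mapAt dec5 k w))) (g (mapAt dec5 k w)))
  A-neighbours {N} {a} {b} {a'} {b'} g w hw = begin
    when (does (inΣ? a' b' w)) (sumIf (allVertices N) (λ u → inΣ? a b u ×-dec adj? u w) g)
      ≡⟨ cong (λ β → when β _) (dec-true (inΣ? a' b' w) hw) ⟩
    sumL (allVertices N) (λ u → when (does (inΣ? a b u) ∧ does (adj? u w)) (g u))
      ≈⟨ sumL-cong (allVertices N) (λ u →
           ≈-reflexive (trans (cong (λ β → when (does (inΣ? a b u) ∧ β) (g u)) (does-adj? u w))
                              (trans (when-∧ (does (inΣ? a b u)) (adjacentᵇ u w) (g u))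
                                     (when-comm (does (inΣ? a b u)) (adjacentᵇ u w) (g u))))) ⟩
    sumL (allVertices N) (λ u → when (adjacentᵇ u w) (when (does (inΣ? a b u)) (g u)))
      ≈⟨ sumL-adjacent w (λ u → when (does (inΣ? a b u)) (g u)) ⟩
    _ ∎

  shiftᵇ : ℕ → ℕ → ℕ → ℕ → Z5 → Z5 → Bool
  shiftᵇ δ₁ ε₁ δ₂ ε₂ x y = does (levelShift? δ₁ ε₁ δ₂ ε₂ x y)

  neighbourPair : (Z5 → Z5 → Bool) → (Z5 → Carrier) → Z5 → Carrier
  neighbourPair S h x = when (S x (inc5 x)) (h (inc5 x)) + when (S x (dec5 x)) (h (dec5 x))

  A-local : ∀ {N} {a b a' b' : ℤ} {δ₁ ε₁ δ₂ ε₂} →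
    a ℤ.+ + δ₁ ≡ a' ℤ.+ + ε₁ → b ℤ.+ + δ₂ ≡ b' ℤ.+ + ε₂ → (g : VFun N) (w : Vertex N) → InΣ a' b' w →
    A (a , b) (a' , b') g w
      ≈ ∑[ k < N ] neighbourPair (shiftᵇ δ₁ ε₁ δ₂ ε₂) (λ y → g (w [ k ]≔ y)) (lookup w k)
  A-local {a = a} {b} {δ₁ = δ₁} {ε₁} {δ₂} {ε₂} ha hb g w hw =
    ≈-trans (A-neighbours {a = a} {b} g w hw) (sum-cong-≋ λ k → +-cong (selected k inc5) (selected k dec5))
    where
    selected : ∀ k s → when (does (inΣ? a b (mapAt s k w))) (g (mapAt s k w))
                       ≈ when (shiftᵇ δ₁ ε₁ δ₂ ε₂ (lookup w k) (s (lookup w k))) (g (mapAt s k w))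
    selected k s = ≈-reflexive (cong (λ β → when β (g (mapAt s k w)))
      (does-⇔ (InΣ-[]≔ ha hb w hw k (s (lookup w k)))
              (inΣ? a b (mapAt s k w)) (levelShift? δ₁ ε₁ δ₂ ε₂ (lookup w k) (s (lookup w k)))))

  neighbourPair-refl : ∀ h x → neighbourPair (shiftᵇ 0 0 0 0) h x ≈ when (isLevel 2 x) (h (neg5 x))
  neighbourPair-refl h zero = +-identityˡ 0#
  neighbourPair-refl h (suc zero) = +-identityˡ 0#
  neighbourPair-refl h (suc (suc zero)) = +-identityʳ _
  neighbourPair-refl h (suc (suc (suc zero))) = +-identityˡ _
  neighbourPair-refl h (suc (suc (suc (suc zero)))) = +-identityˡ 0#

  neighbourPair-raise : ∀ h x → neighbourPair (shiftᵇ 1 0 0 1) h x ≈ when (isLevel 1 x) (h (raise5 x))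
  neighbourPair-raise h zero = +-identityˡ 0#
  neighbourPair-raise h (suc zero) = +-identityʳ _
  neighbourPair-raise h (suc (suc zero)) = +-identityˡ 0#
  neighbourPair-raise h (suc (suc (suc zero))) = +-identityˡ 0#
  neighbourPair-raise h (suc (suc (suc (suc zero)))) = +-identityˡ _

  neighbourPair-lower : ∀ h x → neighbourPair (shiftᵇ 0 1 1 0) h x ≈ when (isLevel 2 x) (h (lower5 x))
  neighbourPair-lower h zero = +-identityˡ 0#
  neighbourPair-lower h (suc zero) = +-identityˡ 0#
  neighbourPair-lower h (suc (suc zero)) = +-identityˡ _
  neighbourPair-lower h (suc (suc (suc zero))) = +-identityʳ _
  neighbourPair-lower h (suc (suc (suc (suc zero)))) = +-identityˡ 0#

  module _ {N : ℕ} {a b : ℤ} (g : VFun N) where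

    A-refl : ∀ w → InΣ a b w → A (a , b) (a , b) g w ≈ ∑[ k < N ] when (isLevel 2 (lookup w k)) (g (refl k w))
    A-refl w hw =
      ≈-trans (A-local {a = a} {b} {δ₁ = 0} {0} {0} {0} ≡.refl ≡.refl g w hw)
              (sum-cong-≋ λ k → neighbourPair-refl (λ y → g (w [ k ]≔ y)) (lookup w k))

    A-raise : ∀ {a' b'} → a ℤ.+ + 1 ≡ a' → b ≡ b' ℤ.+ + 1 → ∀ w → InΣ a' b' w →
              A (a , b) (a' , b') g w ≈ ∑[ k < N ] when (isLevel 1 (lookup w k)) (g (mapAt raise5 k w))
    A-raise {a'} {b'} ha hb w hw =
      ≈-trans (A-local {a = a} {b} {δ₁ = 1} {0} {0} {1}
                 (trans ha (sym (ℤP.+-identityʳ a'))) (trans (ℤP.+-identityʳ b) hb) g w hw)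
              (sum-cong-≋ λ k → neighbourPair-raise (λ y → g (w [ k ]≔ y)) (lookup w k))

    A-lower : ∀ {a' b'} → a ≡ a' ℤ.+ + 1 → b ℤ.+ + 1 ≡ b' → ∀ w → InΣ a' b' w →
              A (a , b) (a' , b') g w ≈ ∑[ k < N ] when (isLevel 2 (lookup w k)) (g (lowerAt k w))
    A-lower {a'} {b'} ha hb w hw =
      ≈-trans (A-local {a = a} {b} {δ₁ = 0} {1} {1} {0}
                 (trans (ℤP.+-identityʳ a) ha) (trans hb (sym (ℤP.+-identityʳ b'))) g w hw)
              (sum-cong-≋ λ k → neighbourPair-lower (λ y → g (w [ k ]≔ y)) (lookup w k))

  -- The commutator identity; subscripts p, m, l stand for the index pairs (p, q), (p - 1, q + 1)
  -- and (p + 1, q - 1), so that Aₓᵧ is the subadjacency from Σₓ to Σᵧ.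

  module Commutator (N p q : ℕ) (f : VFun N) where
    open import Algebra.Properties.AbelianGroup +-abelianGroup using (//-rightDividesʳ; //-rightDividesˡ)

    p⁻ q⁺ p⁺ q⁻ : ℤ
    p⁻ = + p ℤ.- + 1
    q⁺ = + q ℤ.+ + 1
    p⁺ = + p ℤ.+ + 1
    q⁻ = + q ℤ.- + 1

    p⁻+1≡p : p⁻ ℤ.+ + 1 ≡ + p
    p⁻+1≡p = ℤ-//-rightDividesˡ (+ 1) (+ p)

    q⁻+1≡q : q⁻ ℤ.+ + 1 ≡ + q
    q⁻+1≡q = ℤ-//-rightDividesˡ (+ 1) (+ q)

    Aₘₘ Aₚₘ Aₚₚ Aₘₚ Aₚₗ : VFun N → VFun N
    Aₘₘ = A (p⁻ , q⁺) (p⁻ , q⁺)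
    Aₚₘ = A (+ p , + q) (p⁻ , q⁺)
    Aₚₚ = A (+ p , + q) (+ p , + q)
    Aₘₚ = A (p⁻ , q⁺) (+ p , + q)
    Aₚₗ = A (+ p , + q) (p⁺ , q⁻)

    D : VFun N
    D = ((Aₘₘ ∘ᵒ Aₚₘ) ⊖ (Aₚₘ ∘ᵒ Aₚₚ)) f

    commutator-diagonal : ∀ {w} → InΣ p⁻ q⁺ w →
                          D w ≈ ∑[ j < N ] when (isLevel 2 (lookup w j)) (f (refl j (lowerAt j w)))
    commutator-diagonal {w} hw = begin
      X - Y               ≈⟨ +-cong X-expansion (-‿cong Y-expansion) ⟩
      X′ - Y′
        ≈⟨ +-congʳ (≈-trans (sum-cong-≋ diagonal) (∑-distrib-+ (λ j → both j j) (λ j → ∑[ i < N ] tail j i))) ⟩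
      (∑[ j < N ] both j j + Y′) - Y′ ≈⟨ //-rightDividesʳ Y′ _ ⟩
      ∑[ j < N ] both j j ≈⟨ sum-cong-≋ (λ j → when-idem (ℓ₂ j) (F j j)) ⟩
      ∑[ j < N ] when (ℓ₂ j) (F j j) ∎
      where
      ℓ₂ : Fin N → Bool
      ℓ₂ i = isLevel 2 (lookup w i)
      F G both tail : Fin N → Fin N → Carrier
      F i j = f (refl i (lowerAt j w))
      G i j = when (isLevel 2 (lookup (refl i w) j)) (f (lowerAt j (refl i w)))
      both i j = when (ℓ₂ i) (when (ℓ₂ j) (F i j))
      tail j i = when (ℓ₂ j) (when (isLevel 2 (lookup (lowerAt j w) i)) (F i j))
      X Y X′ Y′ : Carrier
      X = Aₘₘ (Aₚₘ f) w
      Y = Aₚₘ (Aₚₚ f) w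
      X′ = ∑[ j < N ] ∑[ i < N ] both i j
      Y′ = ∑[ j < N ] ∑[ i < N ] tail j i

      X-expansion : X ≈ X′
      X-expansion = begin
        X  ≈⟨ A-refl (Aₚₘ f) w hw ⟩
        ∑[ i < N ] when (ℓ₂ i) (Aₚₘ f (refl i w))
           ≈⟨ sum-cong-≋ (λ i → when-cong (ℓ₂ i)
                (A-lower {b = + q} f (sym p⁻+1≡p) ≡.refl (refl i w) (refl-InΣ w hw i))) ⟩
        ∑[ i < N ] when (ℓ₂ i) (∑[ j < N ] G i j)
           ≈⟨ sum-cong-≋ (λ i → ≈-trans (∑-when (ℓ₂ i) (G i)) (sum-cong-≋ λ j → ≈-reflexive
                (cong₂ (λ β x → when (ℓ₂ i) (when β (f x)))
                       (cong (λ n → does (n ℕ.≟ 2)) (lev-refl w i j)) (lowerAt-refl w i j)))) ⟩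
        ∑[ i < N ] ∑[ j < N ] both i j ≈⟨ ∑-comm both ⟩
        X′ ∎

      Y-expansion : Y ≈ Y′
      Y-expansion = ≈-trans (A-lower {b = + q} (Aₚₚ f) (sym p⁻+1≡p) ≡.refl w hw) (sum-cong-≋ λ j →
        ≈-trans (when-does-cong (lev (lookup w j) ℕ.≟ 2) λ l →
                   A-refl f (lowerAt j w) (lower-InΣ {b = + q} (sym p⁻+1≡p) ≡.refl w hw l))
                (∑-when (ℓ₂ j) (λ i → when (isLevel 2 (lookup (lowerAt j w) i)) (F i j))))

      diagonal : ∀ j → ∑[ i < N ] both i j ≈ both j j + ∑[ i < N ] tail j i
      diagonal j = ∑-extract j ≈-refl tail-jj≈0 off
        where
        tail-jj≈0 : tail j j ≈ 0#
        tail-jj≈0 = ≈-trans (when-does-cong (lev (lookup w j) ℕ.≟ 2) λ l →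
                      ≈-reflexive (cong (λ β → when β (F j j)) (isLevel-≢ (lookup (lowerAt j w) j)
                        (trans (cong lev (lookup-mapAt w lower5 j)) (lev-lower5 (lookup w j) l)) λ ())))
                    (when-0# (ℓ₂ j))
        off : ∀ i → i ≢ j → both i j ≈ tail j i
        off i i≢j = ≈-reflexive (trans (when-comm (ℓ₂ i) (ℓ₂ j) (F i j))
          (cong (λ x → when (ℓ₂ j) (when (isLevel 2 x) (F i j))) (sym (lookup-mapAt-≢ w lower5 i≢j))))

    module _ {v : Vertex N} (hv : InΣ (+ p) (+ q) v) where

      ℓ₁ ℓ₂ : Fin N → Bool
      ℓ₁ k = isLevel 1 (lookup v k)
      ℓ₂ k = isLevel 2 (lookup v k)

      v↑ v↓ : Fin N → Vertex N
      v↑ k = mapAt raise5 k v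
      v↓ ν = refl ν (lowerAt ν v)

      E : Fin N → Fin N → Carrier
      E k j = f (mapAt raise5 k (v↓ j))

      W : Carrier
      W = ∑[ k < N ] ∑[ j < N ] when (ℓ₁ k) (when (ℓ₂ j) (E k j))

      raise-diagonal : ∀ k → lev (lookup v k) ≡ 1 →
        ∑[ j < N ] when (isLevel 2 (lookup (v↑ k) j)) (f (refl j (lowerAt j (v↑ k))))
          ≈ f (refl k v) + ∑[ j < N ] when (ℓ₂ j) (E k j)
      raise-diagonal k l = ∑-extract k
        (≈-reflexive (cong₂ (λ β x → when β (f x))
          (trans (cong (isLevel 2) (lookup-mapAt v raise5 k)) (isLevel-≡ _ (lev-raise5 _ l)))
          (refl-lowerAt-raise v k l)))
        (≈-reflexive (cong (λ β → when β (E k k)) (isLevel-≢ _ l λ ())))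
        (λ j j≢k → ≈-reflexive (cong₂ (λ β x → when β (f x))
          (cong (isLevel 2) (lookup-mapAt-≢ v raise5 j≢k)) (refl-lowerAt-raise-≢ v j≢k)))

      lower-diagonal : ∀ ν → lev (lookup v ν) ≡ 2 →
        ∑[ k < N ] when (isLevel 1 (lookup (v↓ ν) k)) (f (mapAt raise5 k (v↓ ν)))
          ≈ f (refl ν v) + ∑[ k < N ] when (ℓ₁ k) (E k ν)
      lower-diagonal ν l = ∑-extract ν
        (≈-reflexive (cong₂ (λ β x → when β (f x))
          (trans (cong (isLevel 1) (trans (lookup-mapAt (lowerAt ν v) neg5 ν) (cong neg5 (lookup-mapAt v lower5 ν))))
                 (isLevel-≡ _ (trans (lev-neg5 _) (lev-lower5 _ l))))
          (raise-refl-lowerAt v ν l)))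
        (≈-reflexive (cong (λ β → when β (E ν ν)) (isLevel-≢ _ l λ ())))
        (λ k k≢ν → ≈-reflexive (cong (λ x → when (isLevel 1 x) (E k ν))
          (trans (lookup-mapAt-≢ (lowerAt ν v) neg5 k≢ν) (lookup-mapAt-≢ v lower5 k≢ν))))

      R1′ A0′ : Carrier
      R1′ = ∑[ k < N ] when (ℓ₁ k) (f (refl k v))
      A0′ = ∑[ k < N ] when (ℓ₂ k) (f (refl k v))

      lhs-expansion : Aₘₚ D v ≈ R1′ + W
      lhs-expansion = begin
        Aₘₚ D v ≈⟨ A-raise {a = p⁻} {q⁺} D p⁻+1≡p ≡.refl v hv ⟩
        ∑[ k < N ] when (ℓ₁ k) (D (v↑ k))
          ≈⟨ sum-cong-≋ (λ k → when-does-cong (lev (lookup v k) ℕ.≟ 1) λ l →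
               ≈-trans (commutator-diagonal (raise-InΣ {a = p⁻} {q⁺} p⁻+1≡p ≡.refl v hv l))
                       (raise-diagonal k l)) ⟩
        ∑[ k < N ] when (ℓ₁ k) (f (refl k v) + ∑[ j < N ] when (ℓ₂ j) (E k j))
          ≈⟨ ∑-when-+-∑ ℓ₁ (λ k → f (refl k v)) (λ k j → when (ℓ₂ j) (E k j)) ⟩
        R1′ + W ∎

      rhs-expansion : ∑[ ν < N ] when (ℓ₂ ν) (Aₚₗ f (v↓ ν)) ≈ A0′ + W
      rhs-expansion = begin
        ∑[ ν < N ] when (ℓ₂ ν) (Aₚₗ f (v↓ ν))
          ≈⟨ sum-cong-≋ (λ ν → when-does-cong (lev (lookup v ν) ℕ.≟ 2) λ l →
               ≈-trans (A-raise {a = + p} f ≡.refl (sym q⁻+1≡q) _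
                          (refl-InΣ (lowerAt ν v) (lower-InΣ {a = p⁺} {q⁻} ≡.refl q⁻+1≡q v hv l) ν))
                       (lower-diagonal ν l)) ⟩
        ∑[ ν < N ] when (ℓ₂ ν) (f (refl ν v) + ∑[ k < N ] when (ℓ₁ k) (E k ν))
          ≈⟨ ∑-when-+-∑ ℓ₂ (λ ν → f (refl ν v)) (λ ν k → when (ℓ₁ k) (E k ν)) ⟩
        A0′ + ∑[ ν < N ] ∑[ k < N ] when (ℓ₂ ν) (when (ℓ₁ k) (E k ν))
          ≈⟨ +-congˡ (≈-trans (∑-comm (λ ν k → when (ℓ₂ ν) (when (ℓ₁ k) (E k ν))))
                              (sum-cong-≋ λ k → sum-cong-≋ λ ν → ≈-reflexive (when-comm (ℓ₂ ν) (ℓ₁ k) (E k ν)))) ⟩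
        A0′ + W ∎

      commutator-identity :
        Aₘₚ D v ≈ (R1 f v - A0 f v) + sumIf (allFin N) (λ k → d k v ℕ.≟ 2) (λ ν → ρ ν (Aₚₗ f) (lowerAt ν v))
      commutator-identity = begin
        Aₘₚ D v                        ≈⟨ lhs-expansion ⟩
        R1′ + W                        ≈⟨ +-congʳ (//-rightDividesˡ A0′ R1′) ⟨
        ((R1′ - A0′) + A0′) + W        ≈⟨ +-assoc _ A0′ W ⟩
        (R1′ - A0′) + (A0′ + W)        ≈⟨ +-congˡ rhs-expansion ⟨
        (R1′ - A0′) + ∑[ ν < N ] when (ℓ₂ ν) (Aₚₗ f (v↓ ν))
          ≡⟨ cong₂ _+_ (cong₂ _-_ (sumIf-allFin (λ k → d k v ℕ.≟ 1) (λ k → f (refl k v)))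
                                  (sumIf-allFin (λ k → d k v ℕ.≟ 2) (λ k → f (refl k v))))
                       (sumIf-allFin (λ k → d k v ℕ.≟ 2) (λ ν → ρ ν (Aₚₗ f) (lowerAt ν v))) ⟨
        (R1 f v - A0 f v) + sumIf (allFin N) (λ k → d k v ℕ.≟ 2) (λ ν → ρ ν (Aₚₗ f) (lowerAt ν v)) ∎


mainTheorem11 : {c ℓ : Level} (R : CommutativeRing c ℓ) →
    let open Ops R in (N : ℕ) → 1 ≤ N → (p q : ℕ) → p Data.Nat.+ q ≤ N →
       (f : VFun N) → SupportedIn (+ p) (+ q) f →
       (v : Vertex N) → InΣ (+ p) (+ q) v →
       A ((+ p) Data.Integer.- (+ 1) , (+ q) Data.Integer.+ (+ 1)) (+ p , + q)
         (((A ((+ p) Data.Integer.- (+ 1) , (+ q) Data.Integer.+ (+ 1))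
              ((+ p) Data.Integer.- (+ 1) , (+ q) Data.Integer.+ (+ 1))
            ∘ᵒ A (+ p , + q) ((+ p) Data.Integer.- (+ 1) , (+ q) Data.Integer.+ (+ 1)))
          ⊖ (A (+ p , + q) ((+ p) Data.Integer.- (+ 1) , (+ q) Data.Integer.+ (+ 1))
            ∘ᵒ A (+ p , + q) (+ p , + q))) f) v
       ≈ ((R1 f v - A0 f v)
          + sumIf (allFin N) (λ k → d k v Data.Nat.≟ 2)
              (λ ν → ρ ν (A (+ p , + q) ((+ p) Data.Integer.+ (+ 1) , (+ q) Data.Integer.- (+ 1)) f)
                       (lowerAt ν v)))
mainTheorem11 R N _ p q _ f _ v hv = Commutator.commutator-identity R N p q f hv
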